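{- Let $p$ be a prime with $2$ as a primitive root, let $m\ge1$, and suppose that $v^{(1)},\dots,v^{(m)}\in\mathbb{F}_2^p$ are linearly independent and work together. Then there is a collection of $m$ linearly independent vectors in $\mathbb{F}_2^p$ which work together and which contains $\bar e$.
   Context: Vectors in $\mathbb{F}_2^p$ are indexed $x=(x_0,\dots,x_{p-1})$ with indices mod $p$; $\sigma$ is the cyclic shift $(\sigma x)_{i+1}=x_i$. Vectors $v^{(1)},\dots,v^{(m)}$ work together if for every $x\in\mathbb{F}_2^p$ there is $k\in\{0,\dots,p-1\}$ with $v^{(i)}\cdot\sigma^kx=0$ for all $i\in[m]$. $\bar e\in\mathbb{F}_2^p$ is the vector with $\bar e_0=0$ and $\bar e_i=1$ for $i\ne0$. -}

module Defs where

open import Data.Nat using (ℕ; zero; suc; _+_; _∸_; _^_; _<_; NonZero)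
open import Data.Nat.DivMod using (_%_; m%n<n)
open import Data.Nat.Primality using (Prime)
open import Data.Bool using (Bool; true; false; _∧_; _xor_; not)
open import Data.Fin using (Fin; toℕ; fromℕ<) renaming (zero to fzero; suc to fsuc)
open import Data.Fin.Properties using ()
open import Data.Product using (Σ; ∃; _×_)
open import Relation.Binary.PropositionalEquality using (_≡_; _≢_)

-- Vectors in F_2^n, as functions Fin n → Bool (Bool = F_2, xor = +, ∧ = ·)
Vecℱ : ℕ → Set
Vecℱ n = Fin n → Bool

⊕-sum : (n : ℕ) → (Fin n → Bool) → Bool
⊕-sum zero f = false
⊕-sum (suc n) f = f fzero xor ⊕-sum n (λ i → f (fsuc i))

_·_ : {n : ℕ} → Vecℱ n → Vecℱ n → Bool
_·_ {n} v x = ⊕-sum n (λ i → v i ∧ x i)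

pred-mod : (p : ℕ) → .{{_ : NonZero p}} → Fin p → Fin p
pred-mod p i = fromℕ< (m%n<n (toℕ i + (p ∸ 1)) p)

-- cyclic shift: (σ x)_{i+1} = x_i, i.e. (σ x)_i = x_{i-1 mod p}
σ : (p : ℕ) → .{{_ : NonZero p}} → Vecℱ p → Vecℱ p
σ p x i = x (pred-mod p i)

σ^ : (p : ℕ) → .{{_ : NonZero p}} → ℕ → Vecℱ p → Vecℱ p
σ^ p zero x = x
σ^ p (suc k) x = σ p (σ^ p k x)

WorkTogether : (p : ℕ) → .{{_ : NonZero p}} → (m : ℕ) → (Fin m → Vecℱ p) → Set
WorkTogether p m v =
  (x : Vecℱ p) → Σ ℕ (λ k → k < p × ((i : Fin m) → (v i · σ^ p k x) ≡ false))

lincomb : {n : ℕ} (m : ℕ) → (Fin m → Bool) → (Fin m → Vecℱ n) → Vecℱ n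
lincomb m c v j = ⊕-sum m (λ i → c i ∧ v i j)

LinIndep : {n : ℕ} (m : ℕ) → (Fin m → Vecℱ n) → Set
LinIndep {n} m v =
  (c : Fin m → Bool) → ((j : Fin n) → lincomb m c v j ≡ false) → (i : Fin m) → c i ≡ false

ē : (p : ℕ) → Vecℱ p
ē p i with toℕ i
... | zero = false
... | suc _ = true

TwoPrimitiveRoot : (p : ℕ) → .{{_ : NonZero p}} → Set
TwoPrimitiveRoot p =
  ((2 ^ (p ∸ 1)) % p ≡ 1) ×
  ((k : ℕ) → 0 < k → k < p ∸ 1 → (2 ^ k) % p ≢ 1)

module Submission where

-- Let p be a prime with 2 as a primitive root and q = p - 1.  Identify F₂^p with the
-- group algebra F₂[ℤ/p], where convolution ⊛ is the product and the cyclic shift σᵏ is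
-- translation by k.  Two facts drive the proof:
--   * convolving a family with a fixed a preserves working together, because
--     (a ⊛ v) · σᵏx = v · σᵏ(a ⋆ x) for the correlation ⋆;
--   * convolving with a unit A (B ⊛ A = 𝟙) preserves linear independence.
-- So it suffices to find a unit A with A ⊛ v⁽¹⁾ = ē.  Put u = v⁽¹⁾: u ≠ 0, and wt u = 0
-- since u · σᵏ𝟙⃗ = u · 𝟙⃗ = 0.  Squaring is the Frobenius map, which doubles indices, and
-- 2^q ≡ 1 (mod p) gives u^(2^q) = u; hence e = u^(2^q - 1) is idempotent with u ⊛ e = u.
-- An idempotent is invariant under doubling, so (2 generating (ℤ/p)^×) e is constant off
-- 0; weight 0 and q even force e₀ = 0, and e ≠ 0 as u ≠ 0, so e = ē.  Finally
-- A = e ⊛ u^(2^q - 2) + 𝟙⃗ satisfies A ⊛ u = e and (u + 𝟙⃗) ⊛ A = ē + 𝟙⃗ = 𝟙.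
-- The file develops: sums over F₂; arithmetic in ℤ/p; the group algebra with its
-- Frobenius; powers of 2 modulo p; the idempotent e and unit A; then the theorem.

open import Defs
open import Level using (0ℓ)
open import Data.Nat using (ℕ; zero; suc; _+_; _*_; _∸_; _^_; _≤_; _<_; NonZero; s≤s)
open import Data.Nat.Properties
  using (+-identityʳ; *-identityˡ; *-assoc; +-comm; ^-distribˡ-+-*; m+[n∸m]≡n; m<n⇒0<n∸m; <⇒≤; +-monoˡ-<;
         <-≤-trans; m≤n+m; suc-injective; n<1+n; *-monoʳ-≤; m^n>0)
open import Data.Nat.DivMod
  using (_%_; _/_; m%n<n; m%n%n≡m%n; m<n⇒m%n≡m; [m+kn]%n≡m%n; %-distribˡ-+; %-distribˡ-*; m≡m%n+[m/n]*n)
open import Data.Nat.Divisibility using (m%n≡0⇒n∣m)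
open import Data.Nat.Primality using (Prime; composite-≢)
open import Data.Nat.Tactic.RingSolver using (solve)
open import Data.Bool using (Bool; true; false; _∧_; _xor_)
open import Data.Bool.Properties
  using (xor-∧-commutativeRing; ∧-commutativeMonoid; ∧-comm; ∧-assoc; ∧-idem; ∧-zeroʳ; ∧-identityʳ;
         ∧-distribʳ-xor; ∧-distribˡ-xor; xor-identityʳ)
open import Data.Fin using (Fin; toℕ; fromℕ<; punchOut) renaming (zero to fzero; suc to fsuc)
open import Data.Fin.Properties using (_≟_; toℕ-fromℕ<; toℕ-injective; toℕ<n; pigeonhole; punchOut-injective)
open import Data.Fin.Permutation using (permutation)
open import Data.List using (_∷_; [])
open import Data.Product using (Σ; _×_; _,_; proj₁; proj₂)
open import Data.Sum using (_⊎_; inj₁; inj₂; [_,_]′)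
open import Data.Empty using (⊥-elim)
open import Function.Bundles using (mk⇔)
open import Relation.Nullary using (does; ¬_)
open import Relation.Nullary.Decidable using (dec-true; does-⇔)
open import Relation.Binary.Bundles using (Setoid)
import Relation.Binary.Reasoning.Setoid as SetoidReasoning
open import Relation.Binary.PropositionalEquality
  using (_≡_; _≢_; refl; sym; trans; cong; cong₂; cong-app; subst; _≗_; _→-setoid_; module ≡-Reasoning)
open import Algebra.Bundles using (CommutativeRing; CommutativeMonoid)
import Algebra.Properties.Semiring.Sum as SemiringSum
open import Algebra.Properties.CommutativeSemigroup (CommutativeMonoid.commutativeSemigroup ∧-commutativeMonoid)
  using () renaming (x∙yz≈y∙xz to ∧-swap)

module F₂ = SemiringSum (CommutativeRing.semiring xor-∧-commutativeRing)

⊕-sum≡sum : ∀ n (f : Fin n → Bool) → ⊕-sum n f ≡ F₂.sum f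
⊕-sum≡sum zero    f = refl
⊕-sum≡sum (suc n) f = cong (f fzero xor_) (⊕-sum≡sum n (λ i → f (fsuc i)))

sum-cong : ∀ n {f g : Fin n → Bool} → f ≗ g → ⊕-sum n f ≡ ⊕-sum n g
sum-cong zero    f≗g = refl
sum-cong (suc n) f≗g = cong₂ _xor_ (f≗g fzero) (sum-cong n (λ i → f≗g (fsuc i)))

sum-zero : ∀ n → ⊕-sum n (λ _ → false) ≡ false
sum-zero zero    = refl
sum-zero (suc n) = sum-zero n

sum-xor : ∀ n (f g : Fin n → Bool) → ⊕-sum n (λ i → f i xor g i) ≡ ⊕-sum n f xor ⊕-sum n g
sum-xor n f g = begin
  ⊕-sum n (λ i → f i xor g i)  ≡⟨ ⊕-sum≡sum n _ ⟩
  F₂.sum (λ i → f i xor g i)   ≡⟨ F₂.∑-distrib-+ f g ⟩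
  F₂.sum f xor F₂.sum g        ≡⟨ sym (cong₂ _xor_ (⊕-sum≡sum n f) (⊕-sum≡sum n g)) ⟩
  ⊕-sum n f xor ⊕-sum n g      ∎
  where open ≡-Reasoning

∧-sum : ∀ n b (f : Fin n → Bool) → b ∧ ⊕-sum n f ≡ ⊕-sum n (λ i → b ∧ f i)
∧-sum n b f = begin
  b ∧ ⊕-sum n f              ≡⟨ cong (b ∧_) (⊕-sum≡sum n f) ⟩
  b ∧ F₂.sum f               ≡⟨ F₂.*-distribˡ-sum b f ⟩
  F₂.sum (λ i → b ∧ f i)     ≡⟨ sym (⊕-sum≡sum n _) ⟩
  ⊕-sum n (λ i → b ∧ f i)    ∎
  where open ≡-Reasoning

sum-∧ : ∀ n b (f : Fin n → Bool) → ⊕-sum n f ∧ b ≡ ⊕-sum n (λ i → f i ∧ b)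
sum-∧ n b f = begin
  ⊕-sum n f ∧ b              ≡⟨ ∧-comm _ b ⟩
  b ∧ ⊕-sum n f              ≡⟨ ∧-sum n b f ⟩
  ⊕-sum n (λ i → b ∧ f i)    ≡⟨ sum-cong n (λ i → ∧-comm b (f i)) ⟩
  ⊕-sum n (λ i → f i ∧ b)    ∎
  where open ≡-Reasoning

sum-swap : ∀ m n (f : Fin m → Fin n → Bool) →
           ⊕-sum m (λ i → ⊕-sum n (f i)) ≡ ⊕-sum n (λ j → ⊕-sum m (λ i → f i j))
sum-swap m n f = begin
  ⊕-sum m (λ i → ⊕-sum n (f i))             ≡⟨ sum-cong m (λ i → ⊕-sum≡sum n (f i)) ⟩
  ⊕-sum m (λ i → F₂.sum (f i))              ≡⟨ ⊕-sum≡sum m _ ⟩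
  F₂.sum (λ i → F₂.sum (f i))               ≡⟨ F₂.∑-comm f ⟩
  F₂.sum (λ j → F₂.sum (λ i → f i j))       ≡⟨ sym (⊕-sum≡sum n _) ⟩
  ⊕-sum n (λ j → F₂.sum (λ i → f i j))      ≡⟨ sym (sum-cong n (λ j → ⊕-sum≡sum m _)) ⟩
  ⊕-sum n (λ j → ⊕-sum m (λ i → f i j))     ∎
  where open ≡-Reasoning

sum-reindex : ∀ n (f : Fin n → Bool) (g h : Fin n → Fin n) →
              (∀ i → g (h i) ≡ i) → (∀ i → h (g i) ≡ i) →
              ⊕-sum n f ≡ ⊕-sum n (λ i → f (g i))
sum-reindex n f g h gh hg = begin
  ⊕-sum n f                 ≡⟨ ⊕-sum≡sum n f ⟩
  F₂.sum f                  ≡⟨ F₂.∑-permute f (permutation g h gh hg) ⟩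
  F₂.sum (λ i → f (g i))    ≡⟨ sym (⊕-sum≡sum n _) ⟩
  ⊕-sum n (λ i → f (g i))   ∎
  where open ≡-Reasoning

sum-indicator : ∀ n (f : Fin n → Bool) (c : Fin n) → ⊕-sum n (λ i → f i ∧ does (i ≟ c)) ≡ f c
sum-indicator (suc n) f fzero = begin
  f fzero ∧ true xor ⊕-sum n (λ i → f (fsuc i) ∧ false)
    ≡⟨ cong₂ _xor_ (∧-identityʳ (f fzero)) (sum-cong n (λ i → ∧-zeroʳ (f (fsuc i)))) ⟩
  f fzero xor ⊕-sum n (λ _ → false)  ≡⟨ cong (f fzero xor_) (sum-zero n) ⟩
  f fzero xor false                  ≡⟨ xor-identityʳ (f fzero) ⟩
  f fzero                            ∎
  where open ≡-Reasoning
sum-indicator (suc n) f (fsuc c) =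
  trans (cong (_xor ⊕-sum n (λ i → f (fsuc i) ∧ does (i ≟ c))) (∧-zeroʳ (f fzero)))
        (sum-indicator n (λ i → f (fsuc i)) c)

sum-even-constant : ∀ {n} h → n ≡ h * 2 → ∀ b (f : Fin n → Bool) → (∀ i → f i ≡ b) →
                    ⊕-sum n f ≡ false
sum-even-constant zero    refl _ _ _   = refl
sum-even-constant (suc h) refl b f f≡b = begin
  f fzero xor (f (fsuc fzero) xor ⊕-sum (h * 2) (λ i → f (fsuc (fsuc i))))
    ≡⟨ cong₂ (λ x y → x xor (y xor _)) (f≡b fzero) (f≡b (fsuc fzero)) ⟩
  b xor (b xor ⊕-sum (h * 2) (λ i → f (fsuc (fsuc i))))
    ≡⟨ cong (λ s → b xor (b xor s)) (sum-even-constant h refl b _ (λ i → f≡b (fsuc (fsuc i)))) ⟩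
  b xor (b xor false)
    ≡⟨ cancel b ⟩
  false ∎
  where
  open ≡-Reasoning
  cancel : ∀ b → b xor (b xor false) ≡ false
  cancel true  = refl
  cancel false = refl

-- A member of a linearly independent family is nonzero: test independence on its indicator.
independent-nonzero : ∀ {n m} {v : Fin m → Vecℱ n} → LinIndep m v → ∀ i → ¬ (v i ≗ (λ _ → false))
independent-nonzero {m = m} {v} indep i vᵢ≗0 = true≢false (begin
  true                ≡⟨ dec-true (i ≟ i) refl ⟨
  does (i ≟ i)        ≡⟨ indep (λ k → does (k ≟ i)) combination-zero i ⟩
  false               ∎)
  where
  open ≡-Reasoning
  true≢false : true ≢ false
  true≢false ()
  combination-zero : ∀ j → lincomb m (λ k → does (k ≟ i)) v j ≡ false
  combination-zero j = trans (sum-cong m (λ k → ∧-comm (does (k ≟ i)) (v k j)))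
                             (trans (sum-indicator m (λ k → v k j) i) (vᵢ≗0 j))

-- Arithmetic in ℤ/p for p = q + 1, with residues represented by Fin p.  Every identity
-- between residues is proved by computing modulo p, where the ring solver applies.
module Cyclic (q : ℕ) where

  p : ℕ
  p = suc q

  ι : ℕ → Fin p
  ι n = fromℕ< (m%n<n n p)

  -- Congruence modulo p (a record, so that its arguments can be inferred).
  infix 4 _≡ₚ_
  record _≡ₚ_ (a b : ℕ) : Set where
    constructor by-%
    field same-% : a % p ≡ b % p
  open _≡ₚ_ public

  ≡ₚ-setoid : Setoid 0ℓ 0ℓ
  ≡ₚ-setoid = record
    { Carrier = ℕ
    ; _≈_ = _≡ₚ_
    ; isEquivalence = record
      { refl  = by-% refl
      ; sym   = λ a≡b → by-% (sym (same-% a≡b))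
      ; trans = λ a≡b b≡c → by-% (trans (same-% a≡b) (same-% b≡c))
      }
    }

  module ≡ₚ-Reasoning = SetoidReasoning ≡ₚ-setoid
  open Setoid ≡ₚ-setoid public using () renaming (refl to ≡ₚ-refl; sym to ≡ₚ-sym)

  +-congₚ : ∀ {a a′ b b′} → a ≡ₚ a′ → b ≡ₚ b′ → a + b ≡ₚ a′ + b′
  +-congₚ {a} {a′} {b} {b′} (by-% e) (by-% f) = by-% (begin
    (a + b) % p              ≡⟨ %-distribˡ-+ a b p ⟩
    (a % p + b % p) % p      ≡⟨ cong₂ (λ x y → (x + y) % p) e f ⟩
    (a′ % p + b′ % p) % p    ≡⟨ %-distribˡ-+ a′ b′ p ⟨
    (a′ + b′) % p            ∎)
    where open ≡-Reasoning

  *-congₚ : ∀ {a a′ b b′} → a ≡ₚ a′ → b ≡ₚ b′ → a * b ≡ₚ a′ * b′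
  *-congₚ {a} {a′} {b} {b′} (by-% e) (by-% f) = by-% (begin
    (a * b) % p              ≡⟨ %-distribˡ-* a b p ⟩
    (a % p * (b % p)) % p    ≡⟨ cong₂ (λ x y → (x * y) % p) e f ⟩
    (a′ % p * (b′ % p)) % p  ≡⟨ %-distribˡ-* a′ b′ p ⟨
    (a′ * b′) % p            ∎)
    where open ≡-Reasoning

  +-multipleₚ : ∀ a k → a + k * p ≡ₚ a
  +-multipleₚ a k = by-% ([m+kn]%n≡m%n a k p)

  toℕ-ι : ∀ a → toℕ (ι a) ≡ₚ a
  toℕ-ι a = by-% (trans (cong (_% p) (toℕ-fromℕ< (m%n<n a p))) (m%n%n≡m%n a p))

  ι-cong : ∀ {a b} → a ≡ₚ b → ι a ≡ ι b
  ι-cong {a} {b} (by-% e) =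
    toℕ-injective (trans (toℕ-fromℕ< (m%n<n a p)) (trans e (sym (toℕ-fromℕ< (m%n<n b p)))))

  ι-complete : ∀ {a b} → ι a ≡ ι b → a ≡ₚ b
  ι-complete {a} {b} e =
    Setoid.trans ≡ₚ-setoid (≡ₚ-sym (toℕ-ι a)) (subst (λ i → toℕ i ≡ₚ b) (sym e) (toℕ-ι b))

  ι-sound : ∀ {a} i → a ≡ₚ toℕ i → ι a ≡ i
  ι-sound i a≡i = trans (ι-cong a≡i) (toℕ-injective (trans (toℕ-fromℕ< _) (m<n⇒m%n≡m (toℕ<n i))))

  -- Addition and subtraction in ℤ/p; subtraction uses q ≡ -1 (mod p).
  infixl 6 _⊞_ _⊟_
  _⊞_ : Fin p → Fin p → Fin p
  i ⊞ j = ι (toℕ i + toℕ j)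

  _⊟_ : Fin p → Fin p → Fin p
  j ⊟ i = ι (toℕ j + toℕ i * q)

  scale : ℕ → Fin p → Fin p
  scale t i = ι (t * toℕ i)

  ⊞-comm : ∀ i j → i ⊞ j ≡ j ⊞ i
  ⊞-comm i j = cong ι (+-comm (toℕ i) (toℕ j))

  ⊟-⊞-cancel : ∀ j i → (j ⊟ i) ⊞ i ≡ j
  ⊟-⊞-cancel j i = ι-sound j (mod-p (toℕ j) (toℕ i))
    where
    mod-p : ∀ a b → toℕ (ι (a + b * q)) + b ≡ₚ a
    mod-p a b = begin
      toℕ (ι (a + b * q)) + b   ≈⟨ +-congₚ (toℕ-ι (a + b * q)) ≡ₚ-refl ⟩
      a + b * q + b             ≡⟨ solve (a ∷ b ∷ q ∷ []) ⟩
      a + b * suc q             ≈⟨ +-multipleₚ a b ⟩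
      a                         ∎
      where open ≡ₚ-Reasoning

  ⊞-⊟-cancel : ∀ j i → (j ⊞ i) ⊟ i ≡ j
  ⊞-⊟-cancel j i = ι-sound j (mod-p (toℕ j) (toℕ i))
    where
    mod-p : ∀ a b → toℕ (ι (a + b)) + b * q ≡ₚ a
    mod-p a b = begin
      toℕ (ι (a + b)) + b * q   ≈⟨ +-congₚ (toℕ-ι (a + b)) ≡ₚ-refl ⟩
      a + b + b * q             ≡⟨ solve (a ∷ b ∷ q ∷ []) ⟩
      a + b * suc q             ≈⟨ +-multipleₚ a b ⟩
      a                         ∎
      where open ≡ₚ-Reasoning

  ⊞-⊟-cancelˡ : ∀ k l → (k ⊞ l) ⊟ k ≡ l
  ⊞-⊟-cancelˡ k l = trans (cong (_⊟ k) (⊞-comm k l)) (⊞-⊟-cancel l k)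

  ⊟-involutive : ∀ j i → j ⊟ (j ⊟ i) ≡ i
  ⊟-involutive j i = ι-sound i (mod-p (toℕ j) (toℕ i))
    where
    mod-p : ∀ a b → a + toℕ (ι (a + b * q)) * q ≡ₚ b
    mod-p a b = begin
      a + toℕ (ι (a + b * q)) * q          ≈⟨ +-congₚ ≡ₚ-refl (*-congₚ (toℕ-ι (a + b * q)) ≡ₚ-refl) ⟩
      a + (a + b * q) * q                  ≈⟨ +-multipleₚ (a + (a + b * q) * q) (2 * b) ⟨
      a + (a + b * q) * q + 2 * b * suc q  ≡⟨ solve (a ∷ b ∷ q ∷ []) ⟩
      b + (a + b * suc q) * suc q          ≈⟨ +-multipleₚ b (a + b * suc q) ⟩
      b                                    ∎
      where open ≡ₚ-Reasoning

  ⊟-⊞ : ∀ j k l → j ⊟ (k ⊞ l) ≡ (j ⊟ k) ⊟ l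
  ⊟-⊞ j k l = ι-cong (mod-p (toℕ j) (toℕ k) (toℕ l))
    where
    mod-p : ∀ a b c → a + toℕ (ι (b + c)) * q ≡ₚ toℕ (ι (a + b * q)) + c * q
    mod-p a b c = begin
      a + toℕ (ι (b + c)) * q        ≈⟨ +-congₚ ≡ₚ-refl (*-congₚ (toℕ-ι (b + c)) ≡ₚ-refl) ⟩
      a + (b + c) * q                ≡⟨ solve (a ∷ b ∷ c ∷ q ∷ []) ⟩
      a + b * q + c * q              ≈⟨ +-congₚ (toℕ-ι (a + b * q)) ≡ₚ-refl ⟨
      toℕ (ι (a + b * q)) + c * q    ∎
      where open ≡ₚ-Reasoning

  ⊟-zero : ∀ j → j ⊟ ι 0 ≡ j
  ⊟-zero j = ι-sound {toℕ j + 0} j (by-% (cong (_% p) (+-identityʳ (toℕ j))))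

  ⊟-⊞-comm : ∀ j i k → (j ⊟ k) ⊞ i ≡ (j ⊞ i) ⊟ k
  ⊟-⊞-comm j i k = ι-cong (mod-p (toℕ j) (toℕ i) (toℕ k))
    where
    mod-p : ∀ a b c → toℕ (ι (a + c * q)) + b ≡ₚ toℕ (ι (a + b)) + c * q
    mod-p a b c = begin
      toℕ (ι (a + c * q)) + b   ≈⟨ +-congₚ (toℕ-ι (a + c * q)) ≡ₚ-refl ⟩
      a + c * q + b             ≡⟨ solve (a ∷ b ∷ c ∷ q ∷ []) ⟩
      a + b + c * q             ≈⟨ +-congₚ (toℕ-ι (a + b)) ≡ₚ-refl ⟨
      toℕ (ι (a + b)) + c * q   ∎
      where open ≡ₚ-Reasoning

  ι-double : ∀ n → ι (2 * n) ≡ ι n ⊞ ι n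
  ι-double n = ι-cong (begin
    2 * n                        ≡⟨ solve (n ∷ []) ⟩
    n + n                        ≈⟨ +-congₚ (toℕ-ι n) (toℕ-ι n) ⟨
    toℕ (ι n) + toℕ (ι n)        ∎)
    where open ≡ₚ-Reasoning

  scale-double : ∀ t i → scale t i ⊞ scale t i ≡ scale (2 * t) i
  scale-double t i = trans (sym (ι-double (t * toℕ i))) (cong ι (sym (*-assoc 2 t (toℕ i))))

  scale-one : ∀ {t} → t ≡ₚ 1 → ∀ i → scale t i ≡ i
  scale-one {t} t≡1 i = ι-sound i (begin
    t * toℕ i   ≈⟨ *-congₚ t≡1 ≡ₚ-refl ⟩
    1 * toℕ i   ≡⟨ *-identityˡ (toℕ i) ⟩
    toℕ i       ∎)
    where open ≡ₚ-Reasoning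

  scale-halves : ∀ {t} → 2 * t ≡ₚ 1 → ∀ i → scale t (i ⊞ i) ≡ i
  scale-halves {t} 2t≡1 i = trans (ι-cong (mod-p (toℕ i))) (scale-one {2 * t} 2t≡1 i)
    where
    mod-p : ∀ a → t * toℕ (ι (a + a)) ≡ₚ 2 * t * a
    mod-p a = begin
      t * toℕ (ι (a + a))   ≈⟨ *-congₚ (≡ₚ-refl {t}) (toℕ-ι (a + a)) ⟩
      t * (a + a)           ≡⟨ solve (t ∷ a ∷ []) ⟩
      2 * t * a             ∎
      where open ≡ₚ-Reasoning

  σ^-at : ∀ k (x : Vecℱ p) i → σ^ p k x i ≡ x (i ⊟ ι k)
  σ^-at zero    x i = cong x (sym (⊟-zero i))
  σ^-at (suc k) x i = trans (σ^-at k x (ι (toℕ i + q))) (cong x (ι-cong (mod-p (toℕ i))))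
    where
    mod-p : ∀ a → toℕ (ι (a + q)) + toℕ (ι k) * q ≡ₚ a + toℕ (ι (suc k)) * q
    mod-p a = begin
      toℕ (ι (a + q)) + toℕ (ι k) * q   ≈⟨ +-congₚ (toℕ-ι (a + q)) (*-congₚ (toℕ-ι k) ≡ₚ-refl) ⟩
      a + q + k * q                     ≡⟨ solve (a ∷ k ∷ q ∷ []) ⟩
      a + suc k * q                     ≈⟨ +-congₚ ≡ₚ-refl (*-congₚ (toℕ-ι (suc k)) ≡ₚ-refl) ⟨
      a + toℕ (ι (suc k)) * q           ∎
      where open ≡ₚ-Reasoning

-- The group algebra F₂[ℤ/p] on V = F₂^p, with convolution ⊛ as product and unit 𝟙 = δ₀.
-- Pointwise equality ≗ is the equality of V.
module GroupRing (q : ℕ) where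
  open Cyclic q public

  V : Set
  V = Vecℱ p

  module ≗-Reasoning = SetoidReasoning (Fin p →-setoid Bool)
  open Setoid (Fin p →-setoid Bool) public using ()
    renaming (refl to ≗-refl; sym to ≗-sym; trans to ≗-trans)

  Σₚ : (Fin p → Bool) → Bool
  Σₚ = ⊕-sum p

  infixl 6 _⊕_
  _⊕_ : V → V → V
  (a ⊕ b) i = a i xor b i

  𝟘 : V
  𝟘 _ = false

  𝟙⃗ : V
  𝟙⃗ _ = true

  δ : Fin p → V
  δ c i = does (c ≟ i)

  ≟-sym : ∀ (i j : Fin p) → does (i ≟ j) ≡ does (j ≟ i)
  ≟-sym i j = does-⇔ (mk⇔ sym sym) (i ≟ j) (j ≟ i)

  𝟙 : V
  𝟙 = δ (ι 0)

  wt : V → Bool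
  wt a = Σₚ a

  infixl 7 _⊛_
  _⊛_ : V → V → V
  (a ⊛ b) j = Σₚ (λ i → a i ∧ b (j ⊟ i))

  ⊛-cong : ∀ {a a′ b b′} → a ≗ a′ → b ≗ b′ → a ⊛ b ≗ a′ ⊛ b′
  ⊛-cong a≗a′ b≗b′ j = sum-cong p (λ i → cong₂ _∧_ (a≗a′ i) (b≗b′ (j ⊟ i)))

  ⊛-congˡ : ∀ a {b b′} → b ≗ b′ → a ⊛ b ≗ a ⊛ b′
  ⊛-congˡ a = ⊛-cong {a} ≗-refl

  ⊛-congʳ : ∀ {a a′} b → a ≗ a′ → a ⊛ b ≗ a′ ⊛ b
  ⊛-congʳ b a≗a′ = ⊛-cong a≗a′ (≗-refl {b})

  -- Commutativity: reindex i ↦ j - i.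
  ⊛-comm : ∀ a b → a ⊛ b ≗ b ⊛ a
  ⊛-comm a b j = begin
    Σₚ (λ i → a i ∧ b (j ⊟ i))
      ≡⟨ sum-reindex p (λ i → a i ∧ b (j ⊟ i)) (j ⊟_) (j ⊟_) (⊟-involutive j) (⊟-involutive j) ⟩
    Σₚ (λ i → a (j ⊟ i) ∧ b (j ⊟ (j ⊟ i)))
      ≡⟨ sum-cong p (λ i → cong (λ k → a (j ⊟ i) ∧ b k) (⊟-involutive j i)) ⟩
    Σₚ (λ i → a (j ⊟ i) ∧ b i)
      ≡⟨ sum-cong p (λ i → ∧-comm (a (j ⊟ i)) (b i)) ⟩
    Σₚ (λ i → b i ∧ a (j ⊟ i))  ∎
    where open ≡-Reasoning

  ⊛-distribʳ-⊕ : ∀ a b c → (a ⊕ b) ⊛ c ≗ a ⊛ c ⊕ b ⊛ c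
  ⊛-distribʳ-⊕ a b c j = trans (sum-cong p (λ i → ∧-distribʳ-xor (c (j ⊟ i)) (a i) (b i)))
                               (sum-xor p (λ i → a i ∧ c (j ⊟ i)) (λ i → b i ∧ c (j ⊟ i)))

  ⊛-distribˡ-⊕ : ∀ c a b → c ⊛ (a ⊕ b) ≗ c ⊛ a ⊕ c ⊛ b
  ⊛-distribˡ-⊕ c a b j = trans (sum-cong p (λ i → ∧-distribˡ-xor (c i) (a (j ⊟ i)) (b (j ⊟ i))))
                               (sum-xor p (λ i → c i ∧ a (j ⊟ i)) (λ i → c i ∧ b (j ⊟ i)))

  ⊛-scalar : ∀ c s a → c ⊛ (λ i → s ∧ a i) ≗ (λ j → s ∧ (c ⊛ a) j)
  ⊛-scalar c s a j = begin
    Σₚ (λ i → c i ∧ (s ∧ a (j ⊟ i)))   ≡⟨ sum-cong p (λ i → ∧-swap (c i) s (a (j ⊟ i))) ⟩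
    Σₚ (λ i → s ∧ (c i ∧ a (j ⊟ i)))   ≡⟨ ∧-sum p s (λ i → c i ∧ a (j ⊟ i)) ⟨
    s ∧ Σₚ (λ i → c i ∧ a (j ⊟ i))     ∎
    where open ≡-Reasoning

  ⊛-zeroʳ : ∀ a → a ⊛ 𝟘 ≗ 𝟘
  ⊛-zeroʳ a j = trans (sum-cong p (λ i → ∧-zeroʳ (a i))) (sum-zero p)

  -- Associativity: both sides are Σ_{k+l+m=j} a_k b_l c_m.
  ⊛-assoc : ∀ a b c → (a ⊛ b) ⊛ c ≗ a ⊛ (b ⊛ c)
  ⊛-assoc a b c j = begin
    Σₚ (λ i → Σₚ (λ k → a k ∧ b (i ⊟ k)) ∧ c (j ⊟ i))
      ≡⟨ sum-cong p (λ i → trans (sum-∧ p (c (j ⊟ i)) (λ k → a k ∧ b (i ⊟ k)))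
                                   (sum-cong p (λ k → ∧-assoc (a k) (b (i ⊟ k)) (c (j ⊟ i))))) ⟩
    Σₚ (λ i → Σₚ (λ k → a k ∧ (b (i ⊟ k) ∧ c (j ⊟ i))))
      ≡⟨ sum-swap p p (λ i k → a k ∧ (b (i ⊟ k) ∧ c (j ⊟ i))) ⟩
    Σₚ (λ k → Σₚ (λ i → a k ∧ (b (i ⊟ k) ∧ c (j ⊟ i))))
      ≡⟨ sum-cong p (λ k → sym (∧-sum p (a k) (λ i → b (i ⊟ k) ∧ c (j ⊟ i)))) ⟩
    Σₚ (λ k → a k ∧ Σₚ (λ i → b (i ⊟ k) ∧ c (j ⊟ i)))
      ≡⟨ sum-cong p (λ k → cong (a k ∧_) (inner k)) ⟩
    Σₚ (λ k → a k ∧ (b ⊛ c) (j ⊟ k))  ∎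
    where
    open ≡-Reasoning
    -- substitute i = k + l
    inner : ∀ k → Σₚ (λ i → b (i ⊟ k) ∧ c (j ⊟ i)) ≡ (b ⊛ c) (j ⊟ k)
    inner k = trans (sum-reindex p (λ i → b (i ⊟ k) ∧ c (j ⊟ i)) (k ⊞_) (_⊟ k)
                                 (λ i → trans (⊞-comm k (i ⊟ k)) (⊟-⊞-cancel i k)) (⊞-⊟-cancelˡ k))
                    (sum-cong p (λ l → cong₂ _∧_ (cong b (⊞-⊟-cancelˡ k l)) (cong c (⊟-⊞ j k l))))

  δ-⊛ : ∀ c a → δ c ⊛ a ≗ (λ j → a (j ⊟ c))
  δ-⊛ c a j = trans (sum-cong p (λ i → trans (∧-comm (does (c ≟ i)) (a (j ⊟ i)))
                                             (cong (a (j ⊟ i) ∧_) (≟-sym c i))))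
                    (sum-indicator p (λ i → a (j ⊟ i)) c)

  ⊛-identityˡ : ∀ a → 𝟙 ⊛ a ≗ a
  ⊛-identityˡ a j = trans (δ-⊛ (ι 0) a j) (cong a (⊟-zero j))

  ⊛-identityʳ : ∀ a → a ⊛ 𝟙 ≗ a
  ⊛-identityʳ a = ≗-trans (⊛-comm a 𝟙) (⊛-identityˡ a)

  δ-⊛-δ : ∀ c d → δ c ⊛ δ d ≗ δ (c ⊞ d)
  δ-⊛-δ c d l = trans (δ-⊛ c (δ d) l) (does-⇔ (mk⇔ to from) (d ≟ l ⊟ c) (c ⊞ d ≟ l))
    where
    to : d ≡ l ⊟ c → c ⊞ d ≡ l
    to e = trans (⊞-comm c d) (trans (cong (_⊞ c) e) (⊟-⊞-cancel l c))
    from : c ⊞ d ≡ l → d ≡ l ⊟ c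
    from e = trans (sym (⊞-⊟-cancelˡ c d)) (cong (_⊟ c) e)

  ⊛-scalarˡ : ∀ s a c → (λ i → s ∧ a i) ⊛ c ≗ (λ j → s ∧ (a ⊛ c) j)
  ⊛-scalarˡ s a c =
    ≗-trans (⊛-comm (λ i → s ∧ a i) c) (≗-trans (⊛-scalar c s a) (λ j → cong (s ∧_) (⊛-comm c a j)))

  ⊛-𝟙⃗ : ∀ a → a ⊛ 𝟙⃗ ≗ (λ _ → wt a)
  ⊛-𝟙⃗ a j = sum-cong p (λ i → ∧-identityʳ (a i))

  𝟙⃗-⊛ : ∀ a → 𝟙⃗ ⊛ a ≗ (λ _ → wt a)
  𝟙⃗-⊛ a = ≗-trans (⊛-comm 𝟙⃗ a) (⊛-𝟙⃗ a)

  wt-⊛ : ∀ a b → wt (a ⊛ b) ≡ wt a ∧ wt b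
  wt-⊛ a b = begin
    Σₚ (λ j → Σₚ (λ i → a i ∧ b (j ⊟ i)))  ≡⟨ sum-swap p p (λ j i → a i ∧ b (j ⊟ i)) ⟩
    Σₚ (λ i → Σₚ (λ j → a i ∧ b (j ⊟ i)))  ≡⟨ sum-cong p (λ i → sym (∧-sum p (a i) (λ j → b (j ⊟ i)))) ⟩
    Σₚ (λ i → a i ∧ Σₚ (λ j → b (j ⊟ i)))  ≡⟨ sum-cong p (λ i → cong (a i ∧_) (sym (translate i))) ⟩
    Σₚ (λ i → a i ∧ wt b)                  ≡⟨ sum-∧ p (wt b) a ⟨
    wt a ∧ wt b                            ∎
    where
    open ≡-Reasoning
    translate : ∀ i → wt b ≡ Σₚ (λ j → b (j ⊟ i))
    translate i = sum-reindex p b (_⊟ i) (_⊞ i) (λ j → ⊞-⊟-cancel j i) (λ j → ⊟-⊞-cancel j i)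

  ⊛-lincomb : ∀ n c (s : Fin n → Bool) (f : Fin n → V) →
              c ⊛ lincomb n s f ≗ lincomb n s (λ k → c ⊛ f k)
  ⊛-lincomb zero    c s f = ⊛-zeroʳ c
  ⊛-lincomb (suc n) c s f j =
    trans (⊛-distribˡ-⊕ c (λ i → s fzero ∧ f fzero i) (lincomb n (λ k → s (fsuc k)) (λ k → f (fsuc k))) j)
          (cong₂ _xor_ (⊛-scalar c (s fzero) (f fzero) j) (⊛-lincomb n c (λ k → s (fsuc k)) (λ k → f (fsuc k)) j))

  _⋆_ : V → V → V
  (a ⋆ z) l = Σₚ (λ i → a i ∧ z (l ⊞ i))

  ⊛-adjoint : ∀ a v z → (a ⊛ v) · z ≡ v · (a ⋆ z)
  ⊛-adjoint a v z = begin
    Σₚ (λ j → Σₚ (λ i → a i ∧ v (j ⊟ i)) ∧ z j)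
      ≡⟨ sum-cong p (λ j → trans (sum-∧ p (z j) (λ i → a i ∧ v (j ⊟ i)))
                                   (sum-cong p (λ i → ∧-assoc (a i) (v (j ⊟ i)) (z j)))) ⟩
    Σₚ (λ j → Σₚ (λ i → a i ∧ (v (j ⊟ i) ∧ z j)))
      ≡⟨ sum-swap p p (λ j i → a i ∧ (v (j ⊟ i) ∧ z j)) ⟩
    Σₚ (λ i → Σₚ (λ j → a i ∧ (v (j ⊟ i) ∧ z j)))
      ≡⟨ sum-cong p (λ i → trans (sym (∧-sum p (a i) (λ j → v (j ⊟ i) ∧ z j)))
                                   (cong (a i ∧_) (translate i))) ⟩
    Σₚ (λ i → a i ∧ Σₚ (λ l → v l ∧ z (l ⊞ i)))
      ≡⟨ sum-cong p (λ i → trans (∧-sum p (a i) (λ l → v l ∧ z (l ⊞ i)))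
                                   (sum-cong p (λ l → ∧-swap (a i) (v l) (z (l ⊞ i))))) ⟩
    Σₚ (λ i → Σₚ (λ l → v l ∧ (a i ∧ z (l ⊞ i))))
      ≡⟨ sum-swap p p (λ i l → v l ∧ (a i ∧ z (l ⊞ i))) ⟩
    Σₚ (λ l → Σₚ (λ i → v l ∧ (a i ∧ z (l ⊞ i))))
      ≡⟨ sum-cong p (λ l → sym (∧-sum p (v l) (λ i → a i ∧ z (l ⊞ i)))) ⟩
    Σₚ (λ l → v l ∧ (a ⋆ z) l)  ∎
    where
    open ≡-Reasoning
    -- substitute j = l + i
    translate : ∀ i → Σₚ (λ j → v (j ⊟ i) ∧ z j) ≡ Σₚ (λ l → v l ∧ z (l ⊞ i))
    translate i = trans (sum-reindex p (λ j → v (j ⊟ i) ∧ z j) (_⊞ i) (_⊟ i)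
                                     (λ j → ⊟-⊞-cancel j i) (λ j → ⊞-⊟-cancel j i))
                        (sum-cong p (λ l → cong (λ k → v k ∧ z (l ⊞ i)) (⊞-⊟-cancel l i)))

  σ^-⋆ : ∀ k a y → σ^ p k (a ⋆ y) ≗ a ⋆ σ^ p k y
  σ^-⋆ k a y l = trans (σ^-at k (a ⋆ y) l)
    (sum-cong p (λ i → cong (a i ∧_) (trans (cong y (⊟-⊞-comm l i (ι k))) (sym (σ^-at k y (l ⊞ i))))))

  square-⊕ : ∀ a b → (a ⊕ b) ⊛ (a ⊕ b) ≗ a ⊛ a ⊕ b ⊛ b
  square-⊕ a b j = begin
    ((a ⊕ b) ⊛ (a ⊕ b)) j
      ≡⟨ ⊛-distribʳ-⊕ a b (a ⊕ b) j ⟩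
    (a ⊛ (a ⊕ b)) j xor (b ⊛ (a ⊕ b)) j
      ≡⟨ cong₂ _xor_ (⊛-distribˡ-⊕ a a b j) (⊛-distribˡ-⊕ b a b j) ⟩
    ((a ⊛ a) j xor (a ⊛ b) j) xor ((b ⊛ a) j xor (b ⊛ b) j)
      ≡⟨ cong (λ x → ((a ⊛ a) j xor (a ⊛ b) j) xor (x xor (b ⊛ b) j)) (⊛-comm b a j) ⟩
    ((a ⊛ a) j xor (a ⊛ b) j) xor ((a ⊛ b) j xor (b ⊛ b) j)
      ≡⟨ cross-terms-cancel ((a ⊛ a) j) ((a ⊛ b) j) ((b ⊛ b) j) ⟩
    (a ⊛ a) j xor (b ⊛ b) j  ∎
    where
    open ≡-Reasoning
    cross-terms-cancel : ∀ x y z → (x xor y) xor (y xor z) ≡ x xor z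
    cross-terms-cancel false false z = refl
    cross-terms-cancel false true  false = refl
    cross-terms-cancel false true  true  = refl
    cross-terms-cancel true  false z = refl
    cross-terms-cancel true  true  false = refl
    cross-terms-cancel true  true  true  = refl

  -- Squaring commutes with scalars (s ∧ s = s) and hence, by additivity, with lincomb.
  square-scalar : ∀ s a → (λ i → s ∧ a i) ⊛ (λ i → s ∧ a i) ≗ (λ j → s ∧ (a ⊛ a) j)
  square-scalar s a j = begin
    ((λ i → s ∧ a i) ⊛ (λ i → s ∧ a i)) j   ≡⟨ ⊛-scalarˡ s a (λ i → s ∧ a i) j ⟩
    s ∧ (a ⊛ (λ i → s ∧ a i)) j             ≡⟨ cong (s ∧_) (⊛-scalar a s a j) ⟩
    s ∧ (s ∧ (a ⊛ a) j)                     ≡⟨ ∧-assoc s s _ ⟨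
    (s ∧ s) ∧ (a ⊛ a) j                     ≡⟨ cong (_∧ (a ⊛ a) j) (∧-idem s) ⟩
    s ∧ (a ⊛ a) j                           ∎
    where open ≡-Reasoning

  square-lincomb : ∀ n (s : Fin n → Bool) (f : Fin n → V) →
                   lincomb n s f ⊛ lincomb n s f ≗ lincomb n s (λ k → f k ⊛ f k)
  square-lincomb zero    s f = ⊛-zeroʳ 𝟘
  square-lincomb (suc n) s f j =
    trans (square-⊕ (λ i → s fzero ∧ f fzero i) (lincomb n (λ k → s (fsuc k)) (λ k → f (fsuc k))) j)
          (cong₂ _xor_ (square-scalar (s fzero) (f fzero) j) (square-lincomb n (λ k → s (fsuc k)) (λ k → f (fsuc k)) j))

  push : (Fin p → Fin p) → V → V
  push f a = lincomb p a (λ i → δ (f i))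

  push-cong : ∀ {f g} a → f ≗ g → push f a ≗ push g a
  push-cong a f≗g j = sum-cong p (λ i → cong (λ k → a i ∧ does (k ≟ j)) (f≗g i))

  push-id : ∀ a → push (λ i → i) a ≗ a
  push-id a j = sum-indicator p a j

  push-at : ∀ {f g} a → (∀ i → g (f i) ≡ i) → ∀ c → push f a (f c) ≡ a c
  push-at {f} {g} a gf≡id c =
    trans (sum-cong p (λ i → cong (a i ∧_) (does-⇔ (mk⇔ to from) (f i ≟ f c) (i ≟ c))))
          (sum-indicator p a c)
    where
    to : ∀ {i} → f i ≡ f c → i ≡ c
    to {i} e = trans (sym (gf≡id i)) (trans (cong g e) (gf≡id c))
    from : ∀ {i} → i ≡ c → f i ≡ f c
    from refl = refl

  -- Frobenius on a pushforward doubles the index map, as δ c ⊛ δ c = δ (c + c).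
  square-push : ∀ f a → push f a ⊛ push f a ≗ push (λ i → f i ⊞ f i) a
  square-push f a = ≗-trans (square-lincomb p a (λ i → δ (f i)))
    (λ j → sum-cong p (λ i → cong (a i ∧_) (δ-⊛-δ (f i) (f i) j)))

  pow : V → ℕ → V
  pow a zero    = 𝟙
  pow a (suc n) = a ⊛ pow a n

  pow-+ : ∀ a m n → pow a (m + n) ≗ pow a m ⊛ pow a n
  pow-+ a zero    n = ≗-sym (⊛-identityˡ (pow a n))
  pow-+ a (suc m) n = ≗-trans (⊛-congˡ a (pow-+ a m n)) (≗-sym (⊛-assoc a (pow a m) (pow a n)))

  pow-2^ : ∀ a k → pow a (2 ^ k) ≗ push (scale (2 ^ k)) a
  pow-2^ a zero    =
    ≗-trans (⊛-identityʳ a) (≗-trans (≗-sym (push-id a)) (push-cong a (λ i → sym (scale-one ≡ₚ-refl i))))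
  pow-2^ a (suc k) = begin
    pow a (2 ^ k + (2 ^ k + 0))                         ≈⟨ pow-+ a (2 ^ k) (2 ^ k + 0) ⟩
    pow a (2 ^ k) ⊛ pow a (2 ^ k + 0)
      ≈⟨ ⊛-congˡ (pow a (2 ^ k)) (cong-app (cong (pow a) (+-identityʳ (2 ^ k)))) ⟩
    pow a (2 ^ k) ⊛ pow a (2 ^ k)                       ≈⟨ ⊛-cong (pow-2^ a k) (pow-2^ a k) ⟩
    push (scale (2 ^ k)) a ⊛ push (scale (2 ^ k)) a     ≈⟨ square-push (scale (2 ^ k)) a ⟩
    push (λ i → scale (2 ^ k) i ⊞ scale (2 ^ k) i) a    ≈⟨ push-cong a (scale-double (2 ^ k)) ⟩
    push (scale (2 ^ suc k)) a                          ∎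
    where open ≗-Reasoning

  pow-2^q : 2 ^ q ≡ₚ 1 → ∀ a → pow a (2 ^ q) ≗ a
  pow-2^q 2^q≡1 a = ≗-trans (pow-2^ a q) (≗-trans (push-cong a (scale-one 2^q≡1)) (push-id a))

  dot-cong : ∀ (v : V) {x y} → x ≗ y → v · x ≡ v · y
  dot-cong v x≗y = sum-cong p (λ i → cong (v i ∧_) (x≗y i))

  -- Working together is preserved by convolving every vector with the same a,
  -- since a ⊛ v tested against x is v tested against a ⋆ x.
  ⊛-preserves-working-together : ∀ a m (v : Fin m → V) →
                                 WorkTogether p m v → WorkTogether p m (λ i → a ⊛ v i)
  ⊛-preserves-working-together a m v together x with together (a ⋆ x)
  ... | k , k<p , vᵢ⊥ = k , k<p , λ i → begin
    (a ⊛ v i) · σ^ p k x       ≡⟨ ⊛-adjoint a (v i) (σ^ p k x) ⟩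
    v i · (a ⋆ σ^ p k x)       ≡⟨ dot-cong (v i) (σ^-⋆ k a x) ⟨
    v i · σ^ p k (a ⋆ x)       ≡⟨ vᵢ⊥ i ⟩
    false                      ∎
    where open ≡-Reasoning

  unit-preserves-independence : ∀ A B → B ⊛ A ≗ 𝟙 → ∀ m (v : Fin m → V) →
                                LinIndep m v → LinIndep m (λ i → A ⊛ v i)
  unit-preserves-independence A B B⊛A≗𝟙 m v indep s image-zero = indep s combination-zero
    where
    L : V
    L = lincomb m s v
    combination-zero : L ≗ 𝟘
    combination-zero = begin
      L               ≈⟨ ⊛-identityˡ L ⟨
      𝟙 ⊛ L           ≈⟨ ⊛-congʳ L B⊛A≗𝟙 ⟨
      B ⊛ A ⊛ L       ≈⟨ ⊛-assoc B A L ⟩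
      B ⊛ (A ⊛ L)     ≈⟨ ⊛-congˡ B (≗-trans (⊛-lincomb m A s v) image-zero) ⟩
      B ⊛ 𝟘           ≈⟨ ⊛-zeroʳ B ⟩
      𝟘               ∎
      where open ≗-Reasoning

  -- The shift fixes 𝟙⃗, so vectors working together have weight 0.
  working-together-weight : ∀ m (v : Fin m → V) → WorkTogether p m v → ∀ i → wt (v i) ≡ false
  working-together-weight m v together i with together 𝟙⃗
  ... | k , _ , vᵢ⊥ = begin
    wt (v i)            ≡⟨ sum-cong p (λ j → ∧-identityʳ (v i j)) ⟨
    v i · 𝟙⃗             ≡⟨ dot-cong (v i) (σ^-at k 𝟙⃗) ⟨
    v i · σ^ p k 𝟙⃗      ≡⟨ vᵢ⊥ i ⟩
    false               ∎
    where open ≡-Reasoning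

-- For a prime p = 3 + r, the number p - 1 is even: otherwise 2 would divide p.
prime-pred-even : ∀ r → Prime (3 + r) → Σ ℕ (λ h → 2 + r ≡ h * 2)
prime-pred-even r pr with (3 + r) % 2 in rem | m%n<n (3 + r) 2 | m≡m%n+[m/n]*n (3 + r) 2
... | 0 | _ | _   = ⊥-elim (Prime.notComposite pr (composite-≢ 2 (λ ()) (m%n≡0⇒n∣m (3 + r) 2 rem)))
... | 1 | _ | div = (3 + r) / 2 , suc-injective div
... | suc (suc _) | s≤s (s≤s ()) | _

module PowersOfTwo (r : ℕ) (root : TwoPrimitiveRoot (2 + r)) where
  open Cyclic (suc r)

  q : ℕ
  q = suc r

  2^q≡1 : 2 ^ q ≡ₚ 1
  2^q≡1 = by-% (proj₁ root)

  complete-to-order : ∀ a b → b ≤ q → 2 ^ a ≡ₚ 2 ^ b → 2 ^ (a + (q ∸ b)) ≡ₚ 1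
  complete-to-order a b b≤q 2^a≡2^b = begin
    2 ^ (a + (q ∸ b))      ≡⟨ ^-distribˡ-+-* 2 a (q ∸ b) ⟩
    2 ^ a * 2 ^ (q ∸ b)    ≈⟨ *-congₚ 2^a≡2^b (≡ₚ-refl {2 ^ (q ∸ b)}) ⟩
    2 ^ b * 2 ^ (q ∸ b)    ≡⟨ ^-distribˡ-+-* 2 b (q ∸ b) ⟨
    2 ^ (b + (q ∸ b))      ≡⟨ cong (2 ^_) (m+[n∸m]≡n b≤q) ⟩
    2 ^ q                  ≈⟨ 2^q≡1 ⟩
    1                      ∎
    where open ≡ₚ-Reasoning

  -- If 2^a ≡ 0 then 1 ≡ 2^q = 2^a · 2^(q - a) ≡ 0, impossible as p ≥ 2.
  power-nonzero : ∀ a → a ≤ q → ι (2 ^ a) ≢ fzero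
  power-nonzero a a≤q 2^a≡0 with same-% (begin
    1                      ≈⟨ 2^q≡1 ⟨
    2 ^ q                  ≡⟨ cong (2 ^_) (m+[n∸m]≡n a≤q) ⟨
    2 ^ (a + (q ∸ a))      ≡⟨ ^-distribˡ-+-* 2 a (q ∸ a) ⟩
    2 ^ a * 2 ^ (q ∸ a)    ≈⟨ *-congₚ (ι-complete {2 ^ a} {0} 2^a≡0) (≡ₚ-refl {2 ^ (q ∸ a)}) ⟩
    0                      ∎)
    where open ≡ₚ-Reasoning
  ... | ()

  -- Powers 2^a, 2^b with a < b < q are distinct, as 2 has order q.
  powers-distinct : ∀ {a b} → a < b → b < q → ι (2 ^ a) ≢ ι (2 ^ b)
  powers-distinct {a} {b} a<b b<q 2^a≡2^b =
    proj₂ root (a + (q ∸ b)) (<-≤-trans (m<n⇒0<n∸m b<q) (m≤n+m (q ∸ b) a)) exponent<q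
          (same-% (complete-to-order a b (<⇒≤ b<q) (ι-complete 2^a≡2^b)))
    where
    exponent<q : a + (q ∸ b) < q
    exponent<q = subst (a + (q ∸ b) <_) (m+[n∸m]≡n (<⇒≤ b<q)) (+-monoˡ-< (q ∸ b) a<b)

  candidates : Fin p → Fin (suc q) → Fin p
  candidates j fzero    = j
  candidates j (fsuc a) = ι (2 ^ toℕ a)

  candidates-nonzero : ∀ j → j ≢ fzero → ∀ k → fzero ≢ candidates j k
  candidates-nonzero j j≢0 fzero    = λ e → j≢0 (sym e)
  candidates-nonzero j j≢0 (fsuc a) = λ e → power-nonzero (toℕ a) (<⇒≤ (toℕ<n a)) (sym e)

  -- Pigeonhole on the q + 1 candidates in the q nonzero residues: j must be a power of 2.
  powers-of-two-cover : ∀ j → j ≢ fzero → Σ ℕ (λ k → ι (2 ^ k) ≡ j)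
  powers-of-two-cover j j≢0 with pigeonhole (n<1+n q) (λ k → punchOut (candidates-nonzero j j≢0 k))
  ... | fzero  , fzero  , ()      , _
  ... | fzero  , fsuc a , _       , same =
    toℕ a , sym (punchOut-injective (candidates-nonzero j j≢0 fzero) (candidates-nonzero j j≢0 (fsuc a)) same)
  ... | fsuc a , fzero  , ()      , _
  ... | fsuc a , fsuc b , s≤s a<b , same = ⊥-elim (powers-distinct a<b (toℕ<n b)
    (punchOut-injective (candidates-nonzero j j≢0 (fsuc a)) (candidates-nonzero j j≢0 (fsuc b)) same))

module Normalisation (r : ℕ) (root : TwoPrimitiveRoot (2 + r)) (h : ℕ) (q≡2h : suc r ≡ h * 2) where
  open GroupRing (suc r)
  open PowersOfTwo r root using (2^q≡1; powers-of-two-cover)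

  -- A vector invariant under doubling the index is constant off 0, because
  -- every nonzero residue is a power of 2.
  doubling-invariant-constant : ∀ (a : V) → (∀ j → a (j ⊞ j) ≡ a j) →
                                ∀ j → j ≢ fzero → a j ≡ a (ι 1)
  doubling-invariant-constant a invariant j j≢0 with powers-of-two-cover j j≢0
  ... | k , 2^k≡j = trans (cong a (sym 2^k≡j)) (at-powers k)
    where
    at-powers : ∀ k → a (ι (2 ^ k)) ≡ a (ι 1)
    at-powers zero    = refl
    at-powers (suc k) = trans (cong a (ι-double (2 ^ k))) (trans (invariant (ι (2 ^ k))) (at-powers k))

  -- If moreover wt a = 0, then a vanishes at 0: the other q = 2h terms are equal and cancel.
  doubling-invariant-at-zero : ∀ (a : V) → (∀ j → a (j ⊞ j) ≡ a j) → wt a ≡ false → a fzero ≡ false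
  doubling-invariant-at-zero a invariant wt≡0 = begin
    a fzero                                       ≡⟨ xor-identityʳ (a fzero) ⟨
    a fzero xor false                             ≡⟨ cong (a fzero xor_) off-zero ⟨
    a fzero xor ⊕-sum (suc r) (λ i → a (fsuc i))  ≡⟨ wt≡0 ⟩
    false                                         ∎
    where
    open ≡-Reasoning
    off-zero : ⊕-sum (suc r) (λ i → a (fsuc i)) ≡ false
    off-zero = sum-even-constant h q≡2h (a (ι 1)) (λ i → a (fsuc i))
                 (λ i → doubling-invariant-constant a invariant (fsuc i) (λ ()))

  doubling-invariant-dichotomy : ∀ (a : V) → (∀ j → a (j ⊞ j) ≡ a j) → wt a ≡ false →
                                 a ≗ 𝟘 ⊎ a ≗ ē p
  doubling-invariant-dichotomy a invariant wt≡0 = by-value-at-one (a (ι 1)) refl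
    where
    off-zero : ∀ i → a (fsuc i) ≡ a (ι 1)
    off-zero i = doubling-invariant-constant a invariant (fsuc i) (λ ())
    by-value-at-one : ∀ b → a (ι 1) ≡ b → a ≗ 𝟘 ⊎ a ≗ ē p
    by-value-at-one false a₁≡b = inj₁ λ { fzero    → doubling-invariant-at-zero a invariant wt≡0
                                        ; (fsuc i) → trans (off-zero i) a₁≡b }
    by-value-at-one true  a₁≡b = inj₂ λ { fzero    → doubling-invariant-at-zero a invariant wt≡0
                                        ; (fsuc i) → trans (off-zero i) a₁≡b }

  -- 𝟙⃗ has p = 1 + 2h ones.
  wt-𝟙⃗ : wt 𝟙⃗ ≡ true
  wt-𝟙⃗ = cong (true xor_) (sum-even-constant h q≡2h true (λ _ → true) (λ _ → refl))

  2≤2^q : 2 ≤ 2 ^ suc r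
  2≤2^q = *-monoʳ-≤ 2 (m^n>0 2 r)

  -- For u ≠ 0 of weight 0, e = u^(2^q - 1) is an idempotent with u e = u, hence e = ē,
  -- and A = e c + 𝟙⃗ (c = u^(2^q - 2)) is a unit with inverse u + 𝟙⃗ carrying u to ē.
  module Normaliser (u : V) (wt-u : wt u ≡ false) (u≢0 : ¬ (u ≗ 𝟘)) where

    c : V
    c = pow u (2 ^ suc r ∸ 2)

    e : V
    e = u ⊛ c

    -- u ⊛ e is u^(2^q), which is u by Frobenius periodicity.
    u-⊛-e : u ⊛ e ≗ u
    u-⊛-e = ≗-trans (cong-pow (m+[n∸m]≡n 2≤2^q)) (pow-2^q 2^q≡1 u)
      where
      cong-pow : ∀ {m n} → m ≡ n → pow u m ≗ pow u n
      cong-pow refl = ≗-refl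

    e-idempotent : e ⊛ e ≗ e
    e-idempotent = begin
      u ⊛ c ⊛ e      ≈⟨ ⊛-congʳ e (⊛-comm u c) ⟩
      c ⊛ u ⊛ e      ≈⟨ ⊛-assoc c u e ⟩
      c ⊛ (u ⊛ e)    ≈⟨ ⊛-congˡ c u-⊛-e ⟩
      c ⊛ u          ≈⟨ ⊛-comm c u ⟩
      u ⊛ c          ∎
      where open ≗-Reasoning

    wt-e : wt e ≡ false
    wt-e = trans (wt-⊛ u c) (cong (_∧ wt c) wt-u)

    -- e = e² is the pushforward of e along doubling, and halving inverts doubling.
    e-doubling-invariant : ∀ j → e (j ⊞ j) ≡ e j
    e-doubling-invariant j =
      trans (e≗push (j ⊞ j)) (push-at {λ i → i ⊞ i} {scale (2 ^ r)} e (scale-halves {2 ^ r} 2^q≡1) j)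
      where
      e≗push : e ≗ push (λ i → i ⊞ i) e
      e≗push = begin
        e                                       ≈⟨ e-idempotent ⟨
        e ⊛ e                                   ≈⟨ ⊛-cong (push-id e) (push-id e) ⟨
        push (λ i → i) e ⊛ push (λ i → i) e     ≈⟨ square-push (λ i → i) e ⟩
        push (λ i → i ⊞ i) e                    ∎
        where open ≗-Reasoning

    -- e is doubling-invariant of weight 0, and e ≠ 0 since u e = u ≠ 0.
    e≗ē : e ≗ ē p
    e≗ē = [ (λ e≗𝟘 → ⊥-elim (u≢0 (e≗𝟘⇒u≗𝟘 e≗𝟘))) , (λ e≗ē → e≗ē) ]′
            (doubling-invariant-dichotomy e e-doubling-invariant wt-e)
      where
      e≗𝟘⇒u≗𝟘 : e ≗ 𝟘 → u ≗ 𝟘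
      e≗𝟘⇒u≗𝟘 e≗𝟘 = begin
        u          ≈⟨ u-⊛-e ⟨
        u ⊛ e      ≈⟨ ⊛-congˡ u e≗𝟘 ⟩
        u ⊛ 𝟘      ≈⟨ ⊛-zeroʳ u ⟩
        𝟘          ∎
        where open ≗-Reasoning

    A : V
    A = e ⊛ c ⊕ 𝟙⃗

    A-⊛-u : A ⊛ u ≗ ē p
    A-⊛-u j = begin
      (A ⊛ u) j                      ≡⟨ ⊛-distribʳ-⊕ (e ⊛ c) 𝟙⃗ u j ⟩
      (e ⊛ c ⊛ u) j xor (𝟙⃗ ⊛ u) j    ≡⟨ cong₂ _xor_ (⊛-assoc e c u j) (𝟙⃗-⊛ u j) ⟩
      (e ⊛ (c ⊛ u)) j xor wt u       ≡⟨ cong₂ _xor_ (⊛-congˡ e (⊛-comm c u) j) wt-u ⟩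
      (e ⊛ e) j xor false            ≡⟨ xor-identityʳ ((e ⊛ e) j) ⟩
      (e ⊛ e) j                      ≡⟨ e-idempotent j ⟩
      e j                            ≡⟨ e≗ē j ⟩
      ē p j                          ∎
      where open ≡-Reasoning

    wt-A : wt A ≡ true
    wt-A = begin
      wt (e ⊛ c ⊕ 𝟙⃗)         ≡⟨ sum-xor p (e ⊛ c) 𝟙⃗ ⟩
      wt (e ⊛ c) xor wt 𝟙⃗    ≡⟨ cong₂ _xor_ (trans (wt-⊛ e c) (cong (_∧ wt c) wt-e)) wt-𝟙⃗ ⟩
      true                   ∎
      where open ≡-Reasoning

    B-⊛-A : (u ⊕ 𝟙⃗) ⊛ A ≗ 𝟙
    B-⊛-A j = begin
      ((u ⊕ 𝟙⃗) ⊛ A) j          ≡⟨ ⊛-distribʳ-⊕ u 𝟙⃗ A j ⟩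
      (u ⊛ A) j xor (𝟙⃗ ⊛ A) j  ≡⟨ cong₂ _xor_ (trans (⊛-comm u A j) (A-⊛-u j)) (trans (𝟙⃗-⊛ A j) wt-A) ⟩
      ē p j xor true           ≡⟨ ē-plus-𝟙⃗ j ⟩
      𝟙 j                      ∎
      where
      open ≡-Reasoning
      ē-plus-𝟙⃗ : ∀ j → ē p j xor true ≡ 𝟙 j
      ē-plus-𝟙⃗ fzero    = refl
      ē-plus-𝟙⃗ (fsuc _) = refl

lemma3p4 : (p : ℕ) → .{{_ : NonZero p}} → Prime p → TwoPrimitiveRoot p →
           (m : ℕ) → 1 ≤ m → (v : Fin m → Vecℱ p) →
           LinIndep m v → WorkTogether p m v →
           Σ (Fin m → Vecℱ p) (λ w →
             LinIndep m w × WorkTogether p m w ×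
             Σ (Fin m) (λ j → (i : Fin p) → w j i ≡ ē p i))
-- p = 1 and p = 2 violate 2^(p-1) ≡ 1, and m ≥ 1; the unit A then normalises v⁽¹⁾ to ē.
lemma3p4 1 _ (() , _)
lemma3p4 2 _ (() , _)
lemma3p4 (suc (suc (suc r))) p-prime root (suc m) _ v independent together =
    (λ i → A ⊛ v i)
  , unit-preserves-independence A (v fzero ⊕ 𝟙⃗) B-⊛-A (suc m) v independent
  , ⊛-preserves-working-together A (suc m) v together
  , fzero , A-⊛-u
  where
  open GroupRing (suc (suc r))
  q-even : Σ ℕ (λ h → suc (suc r) ≡ h * 2)
  q-even = prime-pred-even r p-prime
  open Normalisation (suc r) root (proj₁ q-even) (proj₂ q-even)
  open Normaliser (v fzero) (working-together-weight (suc m) v together fzero)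
                            (independent-nonzero {v = v} independent fzero)
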